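{- Let $b$ be an odd integer with $b \equiv \pm 1 \pmod 8$, and let $q$ be a prime such that $2$ is a primitive root modulo $q$ and $q$ does not divide $b$. Suppose $(p_k)_{k=0}^{q-2}$ is a sequence of primes such that $p_k = 2p_{k-1} + b$ for all $1 \leq k \leq q-2$. Then at least one of the following holds: (a) $q$ divides $p_0 + b$; (b) $p_0 = q$; (c) $p_1 = q$; (d) $p_0 = 2$.
   Context: A sequence of primes $(p_k)_{k=0}^{\lambda-1}$ with $p_k = a p_{k-1} + b$ for all $1 \le k \le \lambda-1$ is called a prime chain of length $\lambda$ based on the pair $(a,b)$; here $a=2$ and the length is $q-1$. The paper's standing assumption is that the chains considered are strictly increasing sequences. -}

module Defs where

open import Data.Nat using (ℕ; suc; _≤_; _<_; _^_; _∸_; _%_; NonZero)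
open import Data.Nat.Coprimality using (Coprime)
open import Relation.Binary.PropositionalEquality using (_≢_)
open import Data.Product using (_×_)

PrimitiveRootModPrime : ℕ → (n : ℕ) → .{{NonZero n}} → Set
PrimitiveRootModPrime g n =
  Coprime g n × (∀ m → 1 ≤ m → m < n ∸ 1 → (g ^ m) % n ≢ 1)

-- Write c = p_0 + b, so that p_k = 2^k c - b.  If q ∤ c, then b and the q - 1
-- numbers 2^k c (0 ≤ k < q - 1) are q nonzero residues mod q; by pigeonhole
-- two coincide.  Two powers 2^i c ≡ 2^j c would force 2^(j-i) ≡ 1 below the
-- order q - 1 of 2, so b ≡ 2^k c for some k ≤ q - 2, i.e. q ∣ p_k and hence
-- p_k = q.  If k ≥ 2 and p_0, b are odd with b ≡ ±1 (mod 8), then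
-- q = 2^k c - b ≡ ∓1 (mod 8) because 2 ∣ c; but then 2 is a quadratic residue
-- mod q (second supplement to quadratic reciprocity, proved below by Gauss's
-- comparison of 2^h h! with h! for h = (q - 1)/2), contradicting that 2 is a
-- primitive root.  Hence k ∈ {0, 1}.
module Submission where

open import Defs
open import Data.Nat using (ℕ; suc; _≤_; _<_; _∸_; NonZero)
open import Data.Nat.Primality using (Prime)
open import Data.Integer using (ℤ; +_; _+_; _-_; _*_)
open import Data.Integer.Divisibility using (_∣_)
open import Relation.Nullary using (¬_)
open import Relation.Binary.PropositionalEquality using (_≡_)
open import Data.Sum using (_⊎_)

open import Data.Nat using (zero; pred; _^_; z≤n; s≤s; s≤s⁻¹; ≢-nonZero)
import Data.Nat as ℕ
open import Data.Nat.Properties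
  using (n<1+n; m<m+n; m≤m+n; m∸n≤m; m<n⇒0<n∸m; m+[n∸m]≡n; <-irrefl; <⇒≤; <⇒≤pred; <⇒≱; ≤-<-trans
        ; suc-pred; pred-injective; suc-injective; +-suc; +-identityʳ; *-comm; ^-distribˡ-+-*)
open import Data.Nat.Divisibility as ℕ∣ using (_∣?_; ∣1⇒≡1; ∣⇒≤) renaming (_∣_ to _∣ℕ_)
open import Data.Nat.DivMod using (_%_; [m+kn]%n≡m%n; m<n⇒m%n≡m)
open import Data.Nat.Coprimality using (Coprime)
open import Data.Nat.Primality using (¬prime[0]; ¬prime[1]; euclidsLemma; prime⇒irreducible; prime⇒nonTrivial)
import Data.Nat.Tactic.RingSolver as ℕSolver
open import Data.Integer using (-_; -1ℤ; 1ℤ; ∣_∣) renaming (_^_ to _^ℤ_)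
open import Data.Integer.Properties using (abs-*; pos-*; *-identityˡ; *-identityʳ; +-identityˡ; ^-*-assoc; ^-zeroˡ)
open import Data.Integer.DivMod using (_%ℕ_; _/ℕ_; a≡a%ℕn+[a/ℕn]*n; n%ℕd<d)
open import Data.Integer.Divisibility.Signed as ℤ∣
  using (∣ᵤ⇒∣; ∣⇒∣ᵤ; ∣m⇒∣-m; ∣m∣n⇒∣m+n; ∣m∣n⇒∣m-n; ∣n⇒∣m*n) renaming (_∣_ to _∣ℤ_)
open import Data.Integer.Tactic.RingSolver using (solve-∀)
open import Data.Fin as Fin using (Fin; toℕ; fromℕ<) renaming (_<_ to _<ꟳ_)
open import Data.Fin.Properties using (pigeonhole; toℕ-fromℕ<; toℕ<n)
open import Data.Empty using (⊥-elim)
open import Data.Sum using (inj₁; inj₂; [_,_]) renaming (map to ⊎-map)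
open import Data.Product using (∃; ∃₂; _×_; _,_)
open import Function using (_∘_; id)
open import Relation.Nullary using (yes; no)
open import Relation.Binary.PropositionalEquality using (_≢_; refl; sym; trans; cong; cong₂; subst; module ≡-Reasoning)

-- Three divisibility relations occur: _∣ℕ_ on ℕ, the signed relation _∣ℤ_
-- on ℤ (used for all computations), and the unsigned relation _∣_ of the
-- statement (+ q ∣ x means q ∣ℕ ∣ x ∣); ∣ᵤ⇒∣ and ∣⇒∣ᵤ convert between them.

pow2 : ℕ → ℤ
pow2 k = + (2 ^ k)

pow2-+ : ∀ m n → pow2 (m ℕ.+ n) ≡ pow2 m * pow2 n
pow2-+ m n = trans (cong +_ (^-distribˡ-+-* 2 m n)) (pos-* (2 ^ m) (2 ^ n))

prime∣*⇒∣⊎∣ : ∀ {q} x y → Prime q → + q ∣ℤ x * y → + q ∣ℤ x ⊎ + q ∣ℤ y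
prime∣*⇒∣⊎∣ {q} x y q-prime q∣xy = ⊎-map ∣ᵤ⇒∣ ∣ᵤ⇒∣
  (euclidsLemma ∣ x ∣ ∣ y ∣ q-prime (subst (q ∣ℕ_) (abs-* x y) (∣⇒∣ᵤ q∣xy)))

prime∤* : ∀ {q} x y → Prime q → ¬ (+ q ∣ℤ x) → ¬ (+ q ∣ℤ y) → ¬ (+ q ∣ℤ x * y)
prime∤* x y q-prime q∤x q∤y q∣xy = [ q∤x , q∤y ] (prime∣*⇒∣⊎∣ x y q-prime q∣xy)

prime∣*-cancelˡ : ∀ {q} x y → Prime q → ¬ (+ q ∣ℤ x) → + q ∣ℤ x * y → + q ∣ℤ y
prime∣*-cancelˡ x y q-prime q∤x q∣xy = [ ⊥-elim ∘ q∤x , id ] (prime∣*⇒∣⊎∣ x y q-prime q∣xy)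

prime∤1 : ∀ {q} → Prime q → ¬ (+ q ∣ℤ 1ℤ)
prime∤1 q-prime q∣1 = ¬prime[1] (subst Prime (∣1⇒≡1 (∣⇒∣ᵤ q∣1)) q-prime)

prime∤pow2 : ∀ {q} → Prime q → Coprime 2 q → ∀ k → ¬ (+ q ∣ℤ pow2 k)
prime∤pow2 q-prime _ zero = prime∤1 q-prime
prime∤pow2 {q} q-prime coprime (suc k) q∣2^[1+k] =
  prime∤* (+ 2) (pow2 k) q-prime q∤2 (prime∤pow2 q-prime coprime k)
    (subst (+ q ∣ℤ_) (pos-* 2 (2 ^ k)) q∣2^[1+k])
  where
  q∤2 : ¬ (+ q ∣ℤ + 2)
  q∤2 q∣2 = ¬prime[1] (subst Prime (coprime (∣⇒∣ᵤ q∣2 , ℕ∣.∣-refl)) q-prime)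

prime∣prime⇒≡ : ∀ {q p} → Prime q → Prime p → q ∣ℕ p → p ≡ q
prime∣prime⇒≡ q-prime p-prime q∣p with prime⇒irreducible p-prime q∣p
... | inj₁ refl = ⊥-elim (¬prime[1] q-prime)
... | inj₂ p≡q = sym p≡q

∣m-1⇒m%q≡1 : ∀ n m → 1 < suc n → + suc n ∣ℤ + m - 1ℤ → m % suc n ≡ 1
∣m-1⇒m%q≡1 n zero 1<q q∣-1 = ⊥-elim (<-irrefl refl (subst (1 <_) (∣1⇒≡1 (∣⇒∣ᵤ q∣-1)) 1<q))
∣m-1⇒m%q≡1 n (suc m) 1<q q∣m with ∣⇒∣ᵤ {+ suc n} {+ m} q∣m
... | ℕ∣.divides k refl = trans ([m+kn]%n≡m%n 1 k (suc n)) (m<n⇒m%n≡m 1<q)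

below-order : ∀ {n d} → Prime (suc n) → PrimitiveRootModPrime 2 (suc n) →
  1 ≤ d → d < n → ¬ (+ suc n ∣ℤ pow2 d - 1ℤ)
below-order {n} {d} q-prime (_ , order) 1≤d d<n q∣2^d-1 =
  order d 1≤d d<n (∣m-1⇒m%q≡1 n (2 ^ d) (ℕ.nonTrivial⇒n>1 (suc n) {{prime⇒nonTrivial q-prime}}) q∣2^d-1)

-- Products used in Gauss's proof that 2 is a square modulo primes ≡ ±1 (mod 8).

factorial : ℕ → ℤ
factorial zero = 1ℤ
factorial (suc n) = factorial n * + suc n

evenProduct : ℕ → ℤ
evenProduct zero = 1ℤ
evenProduct (suc n) = evenProduct n * (+ 2 * + suc n)

oddProduct : ℕ → ℤ
oddProduct zero = 1ℤ
oddProduct (suc n) = oddProduct n * (+ 1 + + 2 * + n)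

-- The n largest factors of evenProduct h: 2h · (2h − 2) · … · (2h − 2n + 2).
topEvenProduct : ℕ → ℕ → ℤ
topEvenProduct h zero = 1ℤ
topEvenProduct h (suc n) = topEvenProduct h n * (+ 2 * (+ h - + n))

evenProduct≡2^n*n! : ∀ n → evenProduct n ≡ pow2 n * factorial n
evenProduct≡2^n*n! zero = refl
evenProduct≡2^n*n! (suc n) = begin
  evenProduct n * (+ 2 * + suc n)           ≡⟨ cong (_* (+ 2 * + suc n)) (evenProduct≡2^n*n! n) ⟩
  pow2 n * factorial n * (+ 2 * + suc n)    ≡⟨ regroup (pow2 n) (factorial n) (+ suc n) ⟩
  (+ 2 * pow2 n) * (factorial n * + suc n)  ≡⟨ cong (_* factorial (suc n)) (pos-* 2 (2 ^ n)) ⟨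
  pow2 (suc n) * factorial (suc n)          ∎
  where
  open ≡-Reasoning
  regroup : ∀ P F m → P * F * (+ 2 * m) ≡ (+ 2 * P) * (F * m)
  regroup = solve-∀

evenProduct-split : ∀ a n → evenProduct (a ℕ.+ n) ≡ evenProduct a * topEvenProduct (a ℕ.+ n) n
evenProduct-split a zero rewrite +-identityʳ a = sym (*-identityʳ (evenProduct a))
evenProduct-split a (suc n) rewrite +-suc a n = begin
  evenProduct (suc a ℕ.+ n)                                     ≡⟨ evenProduct-split (suc a) n ⟩
  evenProduct a * (+ 2 * + suc a) * topEvenProduct (suc a ℕ.+ n) n  ≡⟨ regroup (evenProduct a) (+ a) (+ n) _ ⟩
  evenProduct a * topEvenProduct (suc a ℕ.+ n) (suc n)          ∎
  where
  open ≡-Reasoning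
  regroup : ∀ E a n T → E * (+ 2 * (+ 1 + a)) * T ≡ E * (T * (+ 2 * ((+ 1 + (a + n)) - n)))
  regroup = solve-∀

-- Modulo 2h + 1 each factor 2(h − i) is ≡ −(2i + 1), so the n top factors of
-- evenProduct h are ≡ (−1)^n · 1 · 3 · … · (2n − 1).
topEvenProduct≡±oddProduct : ∀ h n →
  + suc (h ℕ.+ h) ∣ℤ topEvenProduct h n - (-1ℤ ^ℤ n) * oddProduct n
topEvenProduct≡±oddProduct h zero = ℤ∣.divides (+ 0) refl
topEvenProduct≡±oddProduct h (suc n) =
  subst (+ suc (h ℕ.+ h) ∣ℤ_) (rearrange (topEvenProduct h n) (-1ℤ ^ℤ n) (oddProduct n) (+ h) (+ n))
    (∣m∣n⇒∣m-n (∣n⇒∣m*n (topEvenProduct h n) ℤ∣.∣-refl)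
               (∣n⇒∣m*n (+ 1 + + 2 * + n) (topEvenProduct≡±oddProduct h n)))
  where
  rearrange : ∀ T s O h n →
    T * (+ 1 + (h + h)) - (+ 1 + + 2 * n) * (T - s * O) ≡ T * (+ 2 * (h - n)) - (-1ℤ * s) * (O * (+ 1 + + 2 * n))
  rearrange = solve-∀

-1^even : ∀ u → -1ℤ ^ℤ (u ℕ.* 2) ≡ 1ℤ
-1^even u = begin
  -1ℤ ^ℤ (u ℕ.* 2)          ≡⟨ cong (-1ℤ ^ℤ_) (*-comm u 2) ⟩
  -1ℤ ^ℤ (2 ℕ.* u)          ≡⟨ ^-*-assoc -1ℤ 2 u ⟨
  (-1ℤ ^ℤ 2) ^ℤ u           ≡⟨ ^-zeroˡ u ⟩
  1ℤ                        ∎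
  where open ≡-Reasoning

factorial-even : ∀ s → factorial (s ℕ.+ s) ≡ evenProduct s * oddProduct s
factorial-odd : ∀ s → factorial (suc (s ℕ.+ s)) ≡ evenProduct s * oddProduct (suc s)

factorial-even zero = refl
factorial-even (suc s) rewrite +-suc s s = begin
  factorial (suc (s ℕ.+ s)) * + suc (suc (s ℕ.+ s))      ≡⟨ cong (_* + suc (suc (s ℕ.+ s))) (factorial-odd s) ⟩
  evenProduct s * oddProduct (suc s) * + suc (suc (s ℕ.+ s)) ≡⟨ regroup (evenProduct s) (oddProduct (suc s)) (+ s) ⟩
  evenProduct (suc s) * oddProduct (suc s)                 ∎
  where
  open ≡-Reasoning
  regroup : ∀ E O s → E * O * (+ 1 + (+ 1 + (s + s))) ≡ E * (+ 2 * (+ 1 + s)) * O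
  regroup = solve-∀

factorial-odd s = begin
  factorial (s ℕ.+ s) * + suc (s ℕ.+ s)               ≡⟨ cong (_* + suc (s ℕ.+ s)) (factorial-even s) ⟩
  evenProduct s * oddProduct s * + suc (s ℕ.+ s)      ≡⟨ regroup (evenProduct s) (oddProduct s) (+ s) ⟩
  evenProduct s * oddProduct (suc s)                  ∎
  where
  open ≡-Reasoning
  regroup : ∀ E O s → E * O * (+ 1 + (s + s)) ≡ E * (O * (+ 1 + + 2 * s))
  regroup = solve-∀

prime∤factorial : ∀ {q} → Prime q → ∀ n → n < q → ¬ (+ q ∣ℤ factorial n)
prime∤factorial q-prime zero _ = prime∤1 q-prime
prime∤factorial q-prime (suc n) 1+n<q =
  prime∤* (factorial n) (+ suc n) q-prime
    (prime∤factorial q-prime n (<⇒≤ 1+n<q))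
    (λ q∣1+n → <⇒≱ 1+n<q (∣⇒≤ (∣⇒∣ᵤ q∣1+n)))

-- Splitting 2^h h! = 2 · 4 · … · 2h
-- after its first s factors and reducing the last t factors mod q gives
-- 2^h h! ≡ (2 · 4 · … · 2s)(1 · 3 · … · (2t − 1)) = h!, hence 2^h ≡ 1 (mod q).
gauss-two : ∀ {n} h s t → n ≡ h ℕ.+ h → h ≡ s ℕ.+ t → 2 ∣ℕ t →
  factorial h ≡ evenProduct s * oddProduct t → Prime (suc n) → + suc n ∣ℤ pow2 h - 1ℤ
gauss-two h s t refl refl (ℕ∣.divides u refl) h!≡ q-prime =
  prime∣*-cancelˡ (factorial h) (pow2 h - 1ℤ) q-prime
    (prime∤factorial q-prime h (s≤s (m≤m+n h h)))
    (subst (q ∣ℤ_) h![2^h-1]≡ (∣n⇒∣m*n (evenProduct s) top≡odd))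
  where
  open ≡-Reasoning
  q : ℤ
  q = + suc (h ℕ.+ h)
  top≡odd : q ∣ℤ topEvenProduct h t - oddProduct t
  top≡odd = subst (λ x → q ∣ℤ topEvenProduct h t - x)
              (trans (cong (_* oddProduct t) (-1^even u)) (*-identityˡ (oddProduct t)))
              (topEvenProduct≡±oddProduct h t)
  rearrange : ∀ E T O → E * (T - O) ≡ E * T - E * O
  rearrange = solve-∀
  factor : ∀ P F → P * F - F ≡ F * (P - 1ℤ)
  factor = solve-∀
  h![2^h-1]≡ : evenProduct s * (topEvenProduct h t - oddProduct t) ≡ factorial h * (pow2 h - 1ℤ)
  h![2^h-1]≡ = begin
    evenProduct s * (topEvenProduct h t - oddProduct t)             ≡⟨ rearrange (evenProduct s) _ _ ⟩
    evenProduct s * topEvenProduct h t - evenProduct s * oddProduct t ≡⟨ cong₂ _-_ (evenProduct-split s t) h!≡ ⟨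
    evenProduct h - factorial h                                     ≡⟨ cong (_- factorial h) (evenProduct≡2^n*n! h) ⟩
    pow2 h * factorial h - factorial h                              ≡⟨ factor (pow2 h) (factorial h) ⟩
    factorial h * (pow2 h - 1ℤ)                                     ∎

half<whole : ∀ {n} h → n ≡ h ℕ.+ h → 1 ≤ h → h < n
half<whole h refl 1≤h = m<m+n h 1≤h

-- Second supplement to quadratic reciprocity (the half needed): for a prime
-- q ≡ ±1 (mod 8), 2^((q−1)/2) ≡ 1 (mod q), so 2 is not a primitive root mod q.
two-not-primitive-root : ∀ n → Prime (suc n) → 8 ∣ℕ n ⊎ 8 ∣ℕ 2 ℕ.+ n →
  ¬ PrimitiveRootModPrime 2 (suc n)
two-not-primitive-root n q-prime (inj₁ (ℕ∣.divides zero refl)) _ = ¬prime[1] q-prime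
-- q = 8(m + 1) + 1: h = 4(m + 1) = s + s with s = 2(m + 1).
two-not-primitive-root n q-prime (inj₁ (ℕ∣.divides (suc m) n≡8[1+m])) root =
  below-order q-prime root (s≤s z≤n) (half<whole h n≡h+h (s≤s z≤n))
    (gauss-two h s s n≡h+h refl (ℕ∣.divides (suc m) refl) (factorial-even s) q-prime)
  where
  s = suc m ℕ.* 2
  h = s ℕ.+ s
  n≡h+h : n ≡ h ℕ.+ h
  n≡h+h = trans n≡8[1+m] (arith m)
    where
    arith : ∀ m → suc m ℕ.* 8 ≡ (suc m ℕ.* 2 ℕ.+ suc m ℕ.* 2) ℕ.+ (suc m ℕ.* 2 ℕ.+ suc m ℕ.* 2)
    arith = ℕSolver.solve-∀
-- q = 8m + 7: h = 4m + 3 = s + t with s = 2m + 1 and t = s + 1 = 2(m + 1).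
two-not-primitive-root n q-prime (inj₂ (ℕ∣.divides (suc m) 2+n≡8[1+m])) root =
  below-order q-prime root (s≤s z≤n) (half<whole h n≡h+h (s≤s z≤n))
    (gauss-two h s t n≡h+h refl (ℕ∣.divides (suc m) refl) h!≡ q-prime)
  where
  s = suc (m ℕ.* 2)
  t = suc s
  h = s ℕ.+ t
  n≡h+h : n ≡ h ℕ.+ h
  n≡h+h = suc-injective (suc-injective (trans 2+n≡8[1+m] (arith m)))
    where
    arith : ∀ m → suc m ℕ.* 8 ≡ 2 ℕ.+ ((suc (m ℕ.* 2) ℕ.+ suc (suc (m ℕ.* 2))) ℕ.+ (suc (m ℕ.* 2) ℕ.+ suc (suc (m ℕ.* 2))))
    arith = ℕSolver.solve-∀
  h!≡ : factorial h ≡ evenProduct s * oddProduct t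
  h!≡ = subst (λ k → factorial k ≡ evenProduct s * oddProduct t) (sym (+-suc s s)) (factorial-odd s)

same-residue⇒∣- : ∀ n x y → x %ℕ suc n ≡ y %ℕ suc n → + suc n ∣ℤ x - y
same-residue⇒∣- n x y same = ℤ∣.divides (x /ℕ suc n - y /ℕ suc n) (begin
  x - y                                                  ≡⟨ cong₂ _-_ (a≡a%ℕn+[a/ℕn]*n x (suc n)) (a≡a%ℕn+[a/ℕn]*n y (suc n)) ⟩
  (+ (x %ℕ suc n) + X * q) - (+ (y %ℕ suc n) + Y * q)    ≡⟨ cong (λ r → (+ r + X * q) - (+ (y %ℕ suc n) + Y * q)) same ⟩
  (+ (y %ℕ suc n) + X * q) - (+ (y %ℕ suc n) + Y * q)    ≡⟨ cancel (+ (y %ℕ suc n)) X Y q ⟩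
  (X - Y) * q                                            ∎)
  where
  open ≡-Reasoning
  q = + suc n
  X = x /ℕ suc n
  Y = y /ℕ suc n
  cancel : ∀ r X Y q → (r + X * q) - (r + Y * q) ≡ (X - Y) * q
  cancel = solve-∀

residue-nonZero : ∀ n x → ¬ (+ suc n ∣ℤ x) → NonZero (x %ℕ suc n)
residue-nonZero n x q∤x = ≢-nonZero λ r≡0 → q∤x (ℤ∣.divides (x /ℕ suc n)
  (trans (a≡a%ℕn+[a/ℕn]*n x (suc n)) (trans (cong (λ r → + r + (x /ℕ suc n) * + suc n) r≡0) (+-identityˡ _))))

pred-residue<n : ∀ n x → ¬ (+ suc n ∣ℤ x) → pred (x %ℕ suc n) < n
pred-residue<n n x q∤x =
  subst (_≤ n) (sym (suc-pred (x %ℕ suc n) {{residue-nonZero n x q∤x}})) (s≤s⁻¹ (n%ℕd<d x (suc n)))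

-- The nonzero residue of x modulo q = n + 1, encoded in Fin n as (remainder − 1).
nonzeroResidue : ∀ n x → ¬ (+ suc n ∣ℤ x) → Fin n
nonzeroResidue n x q∤x = fromℕ< (pred-residue<n n x q∤x)

nonzeroResidue-congruent : ∀ n x y (q∤x : ¬ (+ suc n ∣ℤ x)) (q∤y : ¬ (+ suc n ∣ℤ y)) →
  nonzeroResidue n x q∤x ≡ nonzeroResidue n y q∤y → + suc n ∣ℤ x - y
nonzeroResidue-congruent n x y q∤x q∤y same = same-residue⇒∣- n x y
  (pred-injective {{residue-nonZero n x q∤x}} {{residue-nonZero n y q∤y}}
    (trans (sym (toℕ-fromℕ< (pred-residue<n n x q∤x)))
      (trans (cong toℕ same) (toℕ-fromℕ< (pred-residue<n n y q∤y)))))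

residue-pigeonhole : ∀ n (f : Fin (suc n) → ℤ) → (∀ i → ¬ (+ suc n ∣ℤ f i)) →
  ∃₂ λ i j → i <ꟳ j × + suc n ∣ℤ f i - f j
residue-pigeonhole n f q∤f with pigeonhole (n<1+n n) (λ i → nonzeroResidue n (f i) (q∤f i))
... | i , j , i<j , same = i , j , i<j , nonzeroResidue-congruent n (f i) (f j) (q∤f i) (q∤f j) same

powers-incongruent : ∀ {n i j} c → Prime (suc n) → PrimitiveRootModPrime 2 (suc n) →
  ¬ (+ suc n ∣ℤ c) → i < j → j < n → ¬ (+ suc n ∣ℤ pow2 i * c - pow2 j * c)
powers-incongruent {n} {i} {j} c q-prime root@(coprime , _) q∤c i<j j<n q∣diff =
  below-order q-prime root (m<n⇒0<n∸m i<j) (≤-<-trans (m∸n≤m j i) j<n)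
    (subst (+ suc n ∣ℤ_) (negate (pow2 d))
      (∣m⇒∣-m (prime∣*-cancelˡ (pow2 i * c) (1ℤ - pow2 d) q-prime
        (prime∤* (pow2 i) c q-prime (prime∤pow2 q-prime coprime i) q∤c)
        (subst (+ suc n ∣ℤ_) diff≡ q∣diff))))
  where
  d = j ∸ i
  factor : ∀ P D c → P * c - (P * D) * c ≡ (P * c) * (1ℤ - D)
  factor = solve-∀
  negate : ∀ D → - (1ℤ - D) ≡ D - 1ℤ
  negate = solve-∀
  diff≡ : pow2 i * c - pow2 j * c ≡ (pow2 i * c) * (1ℤ - pow2 d)
  diff≡ = trans (cong (λ k → pow2 i * c - pow2 k * c) (sym (m+[n∸m]≡n (<⇒≤ i<j))))
            (trans (cong (λ P → pow2 i * c - P * c) (pow2-+ i d)) (factor (pow2 i) (pow2 d) c))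

candidates : ∀ n → ℤ → ℤ → Fin (suc n) → ℤ
candidates n b c Fin.zero = b
candidates n b c (Fin.suc i) = pow2 (toℕ i) * c

candidates-nonzero : ∀ {n} b c → Prime (suc n) → Coprime 2 (suc n) →
  ¬ (+ suc n ∣ℤ c) → ¬ (+ suc n ∣ℤ b) → ∀ i → ¬ (+ suc n ∣ℤ candidates n b c i)
candidates-nonzero b c q-prime coprime q∤c q∤b Fin.zero = q∤b
candidates-nonzero b c q-prime coprime q∤c q∤b (Fin.suc i) =
  prime∤* (pow2 (toℕ i)) c q-prime (prime∤pow2 q-prime coprime (toℕ i)) q∤c

-- If 2 is a primitive root mod q and q ∤ b, q ∤ c, then b ≡ 2^k c (mod q)
-- for some 0 ≤ k < q − 1: two candidates are congruent, and two powers
-- cannot be.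
two-powers-reach : ∀ {n} b c → Prime (suc n) → PrimitiveRootModPrime 2 (suc n) →
  ¬ (+ suc n ∣ℤ c) → ¬ (+ suc n ∣ℤ b) → ∃ λ k → k < n × + suc n ∣ℤ pow2 k * c - b
two-powers-reach {n} b c q-prime root@(coprime , _) q∤c q∤b
  with residue-pigeonhole n (candidates n b c) (candidates-nonzero b c q-prime coprime q∤c q∤b)
... | Fin.suc i , Fin.suc j , s≤s i<j , q∣diff =
  ⊥-elim (powers-incongruent c q-prime root q∤c i<j (toℕ<n j) q∣diff)
... | Fin.zero , Fin.suc j , _ , q∣b-2^jc =
  toℕ j , toℕ<n j , subst (+ suc n ∣ℤ_) (negate b (pow2 (toℕ j) * c)) (∣m⇒∣-m q∣b-2^jc)
  where
  negate : ∀ x y → - (x - y) ≡ y - x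
  negate = solve-∀

chain-closed-form : ∀ b (p : ℕ → ℕ) ℓ →
  (∀ k → 1 ≤ k → k ≤ ℓ → + p k ≡ + 2 * + p (k ∸ 1) + b) →
  ∀ k → k ≤ ℓ → + p k ≡ pow2 k * (+ p 0 + b) - b
chain-closed-form b p ℓ recurrence zero _ = shift (+ p 0) b
  where
  shift : ∀ x b → x ≡ 1ℤ * (x + b) - b
  shift = solve-∀
chain-closed-form b p ℓ recurrence (suc k) 1+k≤ℓ = begin
  + p (suc k)                             ≡⟨ recurrence (suc k) (s≤s z≤n) 1+k≤ℓ ⟩
  + 2 * + p k + b                         ≡⟨ cong (λ x → + 2 * x + b) (chain-closed-form b p ℓ recurrence k (<⇒≤ 1+k≤ℓ)) ⟩
  + 2 * (pow2 k * (+ p 0 + b) - b) + b    ≡⟨ double (pow2 k) (+ p 0 + b) b ⟩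
  (+ 2 * pow2 k) * (+ p 0 + b) - b        ≡⟨ cong (λ P → P * (+ p 0 + b) - b) (pos-* 2 (2 ^ k)) ⟨
  pow2 (suc k) * (+ p 0 + b) - b          ∎
  where
  open ≡-Reasoning
  double : ∀ P c b → + 2 * (P * c - b) + b ≡ (+ 2 * P) * c - b
  double = solve-∀

odd⇒2∣x-1 : ∀ x → ¬ (+ 2 ∣ x) → + 2 ∣ℤ x - 1ℤ
odd⇒2∣x-1 x x-odd with x %ℕ 2 | a≡a%ℕn+[a/ℕn]*n x 2 | n%ℕd<d x 2
... | 0 | x≡ | _ = ⊥-elim (x-odd (∣⇒∣ᵤ (ℤ∣.divides (x /ℕ 2) (trans x≡ (+-identityˡ _)))))
... | 1 | x≡ | _ = ℤ∣.divides (x /ℕ 2) (trans (cong (_- 1ℤ) x≡) (cancel (x /ℕ 2 * + 2)))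
  where
  cancel : ∀ y → (1ℤ + y) - 1ℤ ≡ y
  cancel = solve-∀
... | suc (suc _) | _ | s≤s (s≤s ())

odd+odd⇒even : ∀ x y → ¬ (+ 2 ∣ x) → ¬ (+ 2 ∣ y) → + 2 ∣ℤ x + y
odd+odd⇒even x y x-odd y-odd = subst (+ 2 ∣ℤ_) (regroup x y)
  (∣m∣n⇒∣m+n (∣m∣n⇒∣m+n (odd⇒2∣x-1 x x-odd) (odd⇒2∣x-1 y y-odd)) ℤ∣.∣-refl)
  where
  regroup : ∀ x y → (x - 1ℤ) + (y - 1ℤ) + + 2 ≡ x + y
  regroup = solve-∀

8∣2^[k+2][p₀+b] : ∀ p₀ b k → ¬ (+ 2 ∣ + p₀) → ¬ (+ 2 ∣ b) → + 8 ∣ℤ pow2 (2 ℕ.+ k) * (+ p₀ + b)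
8∣2^[k+2][p₀+b] p₀ b k p₀-odd b-odd with odd+odd⇒even (+ p₀) b p₀-odd b-odd
... | ℤ∣.divides m p₀+b≡m*2 = ℤ∣.divides (pow2 k * m) (begin
  pow2 (2 ℕ.+ k) * (+ p₀ + b)   ≡⟨ cong₂ _*_ (pow2-+ 2 k) p₀+b≡m*2 ⟩
  (+ 4 * pow2 k) * (m * + 2)    ≡⟨ regroup (pow2 k) m ⟩
  (pow2 k * m) * + 8            ∎)
  where
  open ≡-Reasoning
  regroup : ∀ P m → (+ 4 * P) * (m * + 2) ≡ (P * m) * + 8
  regroup = solve-∀

late-chain-value-mod-8 : ∀ {n} p₀ b k → ¬ (+ 2 ∣ + p₀) → ¬ (+ 2 ∣ b) →
  (+ 8 ∣ (b - + 1)) ⊎ (+ 8 ∣ (b + + 1)) →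
  + suc n ≡ pow2 (2 ℕ.+ k) * (+ p₀ + b) - b → 8 ∣ℕ n ⊎ 8 ∣ℕ 2 ℕ.+ n
late-chain-value-mod-8 {n} p₀ b k p₀-odd b-odd (inj₁ 8∣b-1) q≡ =
  inj₂ (∣⇒∣ᵤ (subst (+ 8 ∣ℤ_) (trans (shift (pow2 (2 ℕ.+ k) * (+ p₀ + b)) b) (cong (λ x → 1ℤ + x) (sym q≡)))
    (∣m∣n⇒∣m-n (8∣2^[k+2][p₀+b] p₀ b k p₀-odd b-odd) (∣ᵤ⇒∣ 8∣b-1))))
  where
  shift : ∀ X b → X - (b - + 1) ≡ 1ℤ + (X - b)
  shift = solve-∀
late-chain-value-mod-8 {n} p₀ b k p₀-odd b-odd (inj₂ 8∣b+1) q≡ =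
  inj₁ (∣⇒∣ᵤ (subst (+ 8 ∣ℤ_) (trans (shift (pow2 (2 ℕ.+ k) * (+ p₀ + b)) b) (cong (_- 1ℤ) (sym q≡)))
    (∣m∣n⇒∣m-n (8∣2^[k+2][p₀+b] p₀ b k p₀-odd b-odd) (∣ᵤ⇒∣ 8∣b+1))))
  where
  shift : ∀ X b → X - (b + + 1) ≡ (X - b) - 1ℤ
  shift = solve-∀

odd-prime : ∀ {p} → Prime p → p ≢ 2 → ¬ (2 ∣ℕ p)
odd-prime p-prime p≢2 2∣p with prime⇒irreducible p-prime 2∣p
... | inj₂ 2≡p = p≢2 (sym 2≡p)

-- Core of the theorem: if p_0 is odd and q ∤ p_0 + b, then b ≡ 2^k (p_0 + b)
-- (mod q) for some k ≤ q − 2, so q ∣ p_k and p_k = q; by the mod 8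
-- computation and the second supplement, k ≥ 2 is impossible.
chain-meets-q : ∀ b n (p : ℕ → ℕ) → ¬ (+ 2 ∣ b) → (+ 8 ∣ (b - + 1)) ⊎ (+ 8 ∣ (b + + 1)) →
  Prime (suc n) → PrimitiveRootModPrime 2 (suc n) → ¬ (+ suc n ∣ b) →
  (∀ k → k ≤ pred n → Prime (p k)) →
  (∀ k → 1 ≤ k → k ≤ pred n → + p k ≡ + 2 * + p (k ∸ 1) + b) →
  ¬ (2 ∣ℕ p 0) → ¬ (+ suc n ∣ + p 0 + b) → p 0 ≡ suc n ⊎ p 1 ≡ suc n
chain-meets-q b n p b-odd b≡±1 q-prime root q∤b p-prime recurrence p₀-odd q∤c
  with two-powers-reach b (+ p 0 + b) q-prime root (q∤c ∘ ∣⇒∣ᵤ) (q∤b ∘ ∣⇒∣ᵤ)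
... | k , k<n , q∣2^kc-b = early k k≤ (prime∣prime⇒≡ q-prime (p-prime k k≤) (∣⇒∣ᵤ q∣pₖ))
  where
  closed-form : ∀ k → k ≤ pred n → + p k ≡ pow2 k * (+ p 0 + b) - b
  closed-form = chain-closed-form b p (pred n) recurrence
  k≤ : k ≤ pred n
  k≤ = <⇒≤pred k<n
  q∣pₖ : + suc n ∣ℤ + p k
  q∣pₖ = subst (+ suc n ∣ℤ_) (sym (closed-form k k≤)) q∣2^kc-b
  early : ∀ k → k ≤ pred n → p k ≡ suc n → p 0 ≡ suc n ⊎ p 1 ≡ suc n
  early 0 _ = inj₁
  early 1 _ = inj₂
  early (suc (suc k)) k+2≤ pₖ≡q = ⊥-elim (two-not-primitive-root n q-prime
    (late-chain-value-mod-8 (p 0) b k p₀-odd b-odd b≡±1 (trans (cong +_ (sym pₖ≡q)) (closed-form _ k+2≤)))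
    root)

-- The theorem: dispose of p_0 = 2 and q ∣ p_0 + b, then apply chain-meets-q.
theorem3 : (b : ℤ) (q : ℕ) .{{_ : NonZero q}} (p : ℕ → ℕ) →
    ¬ ((+ 2) ∣ b) →
    ((+ 8) ∣ (b - + 1)) ⊎ ((+ 8) ∣ (b + + 1)) →
    Prime q →
    PrimitiveRootModPrime 2 q →
    ¬ ((+ q) ∣ b) →
    (∀ k → k ≤ q ∸ 2 → Prime (p k)) →
    (∀ k → 1 ≤ k → k ≤ q ∸ 2 → + p k ≡ (+ 2) * (+ p (k ∸ 1)) + b) →
    (∀ k → 1 ≤ k → k ≤ q ∸ 2 → p (k ∸ 1) < p k) →
    ((+ q) ∣ (+ p 0 + b)) ⊎ (p 0 ≡ q) ⊎ (p 1 ≡ q) ⊎ (p 0 ≡ 2)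
theorem3 b zero p _ _ q-prime _ _ _ _ _ = ⊥-elim (¬prime[0] q-prime)
theorem3 b (suc n) p b-odd b≡±1 q-prime root q∤b p-prime recurrence _
  with p 0 ℕ.≟ 2 | suc n ∣? ∣ + p 0 + b ∣
... | yes p₀≡2 | _ = inj₂ (inj₂ (inj₂ p₀≡2))
... | no _ | yes q∣p₀+b = inj₁ q∣p₀+b
... | no p₀≢2 | no q∤p₀+b = inj₂ (⊎-map id inj₁
  (chain-meets-q b n p b-odd b≡±1 q-prime root q∤b p-prime recurrence
    (odd-prime (p-prime 0 z≤n) p₀≢2) q∤p₀+b))
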